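{- Let $G$ be a graph and $\mathcal S=\{(A_1,B_1),\dots,(A_p,B_p)\}$ a set of nested separations of $G$, and let $(T,\mathcal V)$, $\mathcal V=(V_t)_{t\in V(T)}$, be the tree-decomposition of $G$ induced by $\mathcal S$. Let $X\subseteq V(G)$ be the set of vertices that appear in exactly one bag of $(T,\mathcal V)$. Then for every $x\in V(G)$: $x\in X$ if and only if $x\notin A\cap B$ for every $(A,B)\in\mathcal S$. Furthermore, if $t\in V(T)$ is a leaf of $T$ then $V_t\cap X\neq\emptyset$. Consequently, for every $(A,B)\in\mathcal S$, $A\cap X\neq\emptyset$ and $B\cap X\neq\emptyset$.
   Context: A separation of $G$ is a pair $(A,B)$ with $A\cup B=V(G)$, $A\setminus B,B\setminus A\ne\emptyset$, no edge between them; $(A,B)$ and $(B,A)$ are identified. $(A,B),(C,D)$ are nested if after possibly swapping $A,B$ and swapping $C,D$, $A\subseteq C$ and $D\subseteq B$. For a tree-decomposition $(T,(V_t))$ and an edge $e=t_1t_2$ of $T$, with $T_1,T_2$ the components of $T-e$ containing $t_1,t_2$, $e$ induces the separation $(\bigcup_{t\in V(T_1)}V_t,\bigcup_{t\in V(T_2)}V_t)$. A set $\mathcal S$ of separations induces $(T,(V_t))$ if $e\mapsto$(separation induced by $e$) is a bijection from $E(T)$ onto $\mathcal S$; for a nested set such a tree-decomposition exists and is unique up to isomorphism. -}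

module Defs where

open import Data.Nat using (ℕ)
open import Data.Fin using (Fin)
open import Data.Fin.Subset using (Subset; _∈_; _∉_; _⊆_)
open import Data.Product using (Σ; ∃; ∃-syntax; _×_; _,_; proj₁; proj₂)
open import Data.Sum using (_⊎_)
open import Data.Unit using (⊤)
open import Relation.Nullary using (¬_)
open import Relation.Binary.PropositionalEquality using (_≡_; _≢_)
open import Function.Bundles using (_⇔_)

record Graph : Set₁ where
  field
    n      : ℕ
    E      : Fin n → Fin n → Set
    E-sym  : ∀ {x y} → E x y → E y x
    E-irr  : ∀ {x} → ¬ E x x

Sep : ℕ → Set
Sep n = Subset n × Subset n

module _ (G : Graph) where
  open Graph G

  IsSeparation : Sep n → Set
  IsSeparation (A , B) =
      (∀ x → x ∈ A ⊎ x ∈ B)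
    × (∃[ x ] (x ∈ A × x ∉ B))
    × (∃[ x ] (x ∈ B × x ∉ A))
    × (∀ x y → x ∈ A → x ∉ B → y ∈ B → y ∉ A → ¬ E x y)

Nested : ∀ {n} → Sep n → Sep n → Set
Nested (A , B) (C , D) =
    (A ⊆ C × D ⊆ B)
  ⊎ (B ⊆ C × D ⊆ A)
  ⊎ (A ⊆ D × C ⊆ B)
  ⊎ (B ⊆ D × C ⊆ A)

module _ {m q : ℕ} (edge : Fin q → Fin m × Fin m) where

  Link : Fin q → Fin m → Fin m → Set
  Link f u w = (edge f ≡ (u , w)) ⊎ (edge f ≡ (w , u))

  data Walk (OkE : Fin q → Set) (OkV : Fin m → Set) : Fin m → Fin m → Set where
    stop : ∀ {u} → OkV u → Walk OkE OkV u u
    step : ∀ {u w v} (f : Fin q) → OkE f → Link f u w → OkV u →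
           Walk OkE OkV w v → Walk OkE OkV u v

  ReachWithout : Fin q → Fin m → Fin m → Set
  ReachWithout f = Walk (λ g → g ≢ f) (λ _ → ⊤)

  Incident : Fin q → Fin m → Set
  Incident f t = (proj₁ (edge f) ≡ t) ⊎ (proj₂ (edge f) ≡ t)

record Tree : Set where
  field
    m         : ℕ
    q         : ℕ
    edge      : Fin q → Fin m × Fin m
    connected : ∀ u v → Walk edge (λ _ → ⊤) (λ _ → ⊤) u v
    bridges   : ∀ f → ¬ ReachWithout edge f (proj₁ (edge f)) (proj₂ (edge f))

  Leaf : Fin m → Set
  Leaf t = Σ (Fin q) λ f → Incident edge f t × (∀ g → Incident edge g t → g ≡ f)

module _ (G : Graph) (T : Tree) where
  open Graph G
  open Tree T

  record IsTreeDecomposition (V : Fin m → Subset n) : Set where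
    field
      cover-vertices : ∀ x → ∃[ t ] (x ∈ V t)
      cover-edges    : ∀ x y → E x y → ∃[ t ] (x ∈ V t × y ∈ V t)
      connected-bags : ∀ x t t' → x ∈ V t → x ∈ V t' →
                       Walk edge (λ _ → ⊤) (λ s → x ∈ V s) t t'

  module _ (V : Fin m → Subset n) where

    InSide : Fin q → Fin m → Fin n → Set
    InSide f u x = ∃[ t ] (ReachWithout edge f u t × x ∈ V t)

    -- the separation induced by the edge f equals (C , D),
    -- up to swapping sides (separations are unordered)
    InducesSep : Fin q → Sep n → Set
    InducesSep f (C , D) =
        ((∀ x → (x ∈ C ⇔ InSide f (proj₁ (edge f)) x))
         × (∀ x → (x ∈ D ⇔ InSide f (proj₂ (edge f)) x)))
      ⊎ ((∀ x → (x ∈ D ⇔ InSide f (proj₁ (edge f)) x))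
         × (∀ x → (x ∈ C ⇔ InSide f (proj₂ (edge f)) x)))

    SameInduced : Fin q → Fin q → Set
    SameInduced f g =
        ((∀ x → (InSide f (proj₁ (edge f)) x ⇔ InSide g (proj₁ (edge g)) x))
         × (∀ x → (InSide f (proj₂ (edge f)) x ⇔ InSide g (proj₂ (edge g)) x)))
      ⊎ ((∀ x → (InSide f (proj₁ (edge f)) x ⇔ InSide g (proj₂ (edge g)) x))
         × (∀ x → (InSide f (proj₂ (edge f)) x ⇔ InSide g (proj₁ (edge g)) x)))

    record Induces {p : ℕ} (S : Fin p → Sep n) : Set where
      field
        injective : ∀ f g → SameInduced f g → f ≡ g
        into      : ∀ f → ∃[ i ] InducesSep f (S i)
        onto      : ∀ i → ∃[ f ] InducesSep f (S i)

    InExactlyOneBag : Fin n → Set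
    InExactlyOneBag x = Σ (Fin m) λ t → x ∈ V t × (∀ t' → x ∈ V t' → t' ≡ t)

-- The bags containing a vertex x form a subtree, so x lies in a single bag iff
-- no edge of T has bags containing x on both of its sides, i.e. iff x lies in
-- no A ∩ B.  If t is a leaf with edge f, the separation induced by f has a
-- vertex x on t's side only; V_t is the only bag on that side, and x cannot
-- spread across f, so x ∈ V_t ∩ X.  Finally, walking away from an edge of T
-- without turning back must stop at a leaf, so each side of every separation
-- contains a leaf bag, and hence a vertex of X.
module Submission where

open import Defs
open import Data.Nat using (ℕ; zero; suc; _+_)
open import Data.Nat.Properties using (+-suc; +-identityʳ; ≤-refl)
open import Data.Fin using (Fin; zero; suc; _≟_)
open import Data.Fin.Properties using (any?; pigeonhole; <⇒≢)
open import Data.Fin.Subset using (Subset; _∈_; _∉_)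
open import Data.Product using (∃-syntax; _×_; _,_; proj₁; proj₂)
open import Data.Sum using (_⊎_; inj₁; inj₂)
open import Data.Unit using (⊤; tt)
open import Data.Empty using (⊥-elim)
open import Relation.Nullary using (¬_; Dec; yes; no)
open import Relation.Nullary.Decidable using (_×-dec_; _⊎-dec_; ¬?)
open import Relation.Binary.PropositionalEquality
  using (_≡_; _≢_; refl; sym; trans; cong; subst; subst₂)
open import Function.Bundles using (_⇔_; mk⇔; Equivalence)
open import Function.Definitions using (Injective)
open Equivalence using (to; from)

module WalkProperties {m q : ℕ} (edge : Fin q → Fin m × Fin m) where

  Link-sym : ∀ {f u w} → Link edge f u w → Link edge f w u
  Link-sym (inj₁ e) = inj₂ e
  Link-sym (inj₂ e) = inj₁ e

  Link⇒Incident : ∀ {f u w} → Link edge f u w → Incident edge f u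
  Link⇒Incident (inj₁ e) = inj₁ (cong proj₁ e)
  Link⇒Incident (inj₂ e) = inj₂ (cong proj₂ e)

  Incident⇒Link : ∀ {f u} → Incident edge f u → ∃[ w ] Link edge f u w
  Incident⇒Link {f} (inj₁ refl) = proj₂ (edge f) , inj₁ refl
  Incident⇒Link {f} (inj₂ refl) = proj₁ (edge f) , inj₂ refl

  incident? : ∀ f u → Dec (Incident edge f u)
  incident? f u = (proj₁ (edge f) ≟ u) ⊎-dec (proj₂ (edge f) ≟ u)

  Link-functional : ∀ {f u w w′} → Link edge f u w → Link edge f u w′ → w ≡ w′
  Link-functional (inj₁ e) (inj₁ e′) = cong proj₂ (trans (sym e) e′)
  Link-functional (inj₁ e) (inj₂ e′) =
    trans (cong proj₂ (trans (sym e) e′)) (cong proj₁ (trans (sym e) e′))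
  Link-functional (inj₂ e) (inj₁ e′) =
    trans (cong proj₁ (trans (sym e) e′)) (cong proj₂ (trans (sym e) e′))
  Link-functional (inj₂ e) (inj₂ e′) = cong proj₁ (trans (sym e) e′)

  Link-endpoint : ∀ {f u w d c} → Link edge f u w → Link edge f d c → u ≡ c ⊎ w ≡ c
  Link-endpoint (inj₁ e) (inj₁ e′) = inj₂ (cong proj₂ (trans (sym e) e′))
  Link-endpoint (inj₁ e) (inj₂ e′) = inj₁ (cong proj₁ (trans (sym e) e′))
  Link-endpoint (inj₂ e) (inj₁ e′) = inj₁ (cong proj₂ (trans (sym e) e′))
  Link-endpoint (inj₂ e) (inj₂ e′) = inj₂ (cong proj₁ (trans (sym e) e′))

  walk-head : ∀ {OkE OkV u v} → Walk edge OkE OkV u v → OkV u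
  walk-head (stop ok) = ok
  walk-head (step _ _ _ ok _) = ok

  _++_ : ∀ {OkE OkV u v w} →
         Walk edge OkE OkV u v → Walk edge OkE OkV v w → Walk edge OkE OkV u w
  stop _ ++ w = w
  step f okf l ok r ++ w = step f okf l ok (r ++ w)

  reverse : ∀ {OkE u v} → Walk edge OkE (λ _ → ⊤) u v → Walk edge OkE (λ _ → ⊤) v u
  reverse (stop ok) = stop ok
  reverse (step f okf l _ r) = reverse r ++ step f okf (Link-sym l) tt (stop tt)

module TreeProperties (T : Tree) where
  open Tree T
  open WalkProperties edge

  Side : Fin q → Fin m → Fin m → Set
  Side = ReachWithout edge

  Link⇒¬Side : ∀ {f u w} → Link edge f u w → ¬ Side f u w
  Link⇒¬Side {f} (inj₁ e) s =
    bridges f (subst₂ (Side f) (sym (cong proj₁ e)) (sym (cong proj₂ e)) s)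
  Link⇒¬Side {f} (inj₂ e) s =
    bridges f (subst₂ (Side f) (sym (cong proj₁ e)) (sym (cong proj₂ e)) (reverse s))

  leaf-side-singleton : ∀ {f a t} → (∀ g → Incident edge g a → g ≡ f) → Side f a t → t ≡ a
  leaf-side-singleton only-f (stop _) = refl
  leaf-side-singleton only-f (step g g≢f l _ _) = ⊥-elim (g≢f (only-f g (Link⇒Incident l)))

  Side-avoids-or-reaches : ∀ {h g d c u t} → Link edge g d c → Side h u t →
                           Side g u t ⊎ Side h u c
  Side-avoids-or-reaches lg (stop ok) = inj₁ (stop ok)
  Side-avoids-or-reaches {g = g} lg (step g′ g′≢h l ok r) with g′ ≟ g
  ... | yes refl with Link-endpoint l lg
  ...   | inj₁ refl = inj₂ (stop tt)
  ...   | inj₂ refl = inj₂ (step g′ g′≢h l ok (stop tt))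
  Side-avoids-or-reaches lg (step g′ g′≢h l ok r) | no g′≢g
    with Side-avoids-or-reaches lg r
  ... | inj₁ r′ = inj₁ (step g′ g′≢g l ok r′)
  ... | inj₂ r′ = inj₂ (step g′ g′≢h l ok r′)

  Side-step : ∀ {g h d c c′ t} → Link edge g d c → Link edge h c c′ → h ≢ g →
              Side h c′ t → Side g c t
  Side-step lg lh h≢g s with Side-avoids-or-reaches lg s
  ... | inj₁ s′ = step _ h≢g lh tt s′
  ... | inj₂ s′ = ⊥-elim (Link⇒¬Side (Link-sym lh) s′)

  -- Each step moves into a smaller side and leaves the previous vertex behind;
  -- the visited vertices stay distinct, so pigeonhole stops the walk at a leaf.
  private
    descend : ∀ fuel k → fuel + k ≡ suc m → ∀ {g d c} → Link edge g d c →
              (visited : Fin k → Fin m) → Injective _≡_ _≡_ visited →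
              (∀ i → ¬ Side g c (visited i)) → ∃[ t ] (Side g c t × Leaf t)
    descend zero k refl _ visited injective _ with pigeonhole ≤-refl visited
    ... | i , j , i<j , same = ⊥-elim (<⇒≢ i<j (injective same))
    descend (suc fuel) k eq {g} {c = c} lg visited injective behind
      with any? (λ h → incident? h c ×-dec ¬? (h ≟ g))
    ... | no no-other = c , stop tt , g , Link⇒Incident (Link-sym lg) , only-g
      where
      only-g : ∀ h → Incident edge h c → h ≡ g
      only-g h ih with h ≟ g
      ... | yes h≡g = h≡g
      ... | no h≢g = ⊥-elim (no-other (h , ih , h≢g))
    ... | yes (h , ih , h≢g) with Incident⇒Link ih
    ...   | c′ , lh
      with descend fuel (suc k) (trans (+-suc fuel k) eq) lh visited′ injective′ behind′
      where
      visited′ : Fin (suc k) → Fin m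
      visited′ zero = c
      visited′ (suc i) = visited i

      injective′ : Injective _≡_ _≡_ visited′
      injective′ {zero} {zero} _ = refl
      injective′ {zero} {suc j} e = ⊥-elim (behind j (subst (Side g c) e (stop tt)))
      injective′ {suc i} {zero} e = ⊥-elim (behind i (subst (Side g c) (sym e) (stop tt)))
      injective′ {suc i} {suc j} e = cong suc (injective e)

      behind′ : ∀ i → ¬ Side h c′ (visited′ i)
      behind′ zero s = Link⇒¬Side (Link-sym lh) s
      behind′ (suc i) s = behind i (Side-step lg lh h≢g s)
    ...     | t , s , leaf = t , Side-step lg lh h≢g s , leaf

  Side-contains-leaf : ∀ {f u w} → Link edge f w u → ∃[ t ] (Side f u t × Leaf t)
  Side-contains-leaf l =
    descend (suc m) 0 (+-identityʳ (suc m)) l (λ ()) (λ { {()} }) (λ ())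

module Decomposition (G : Graph) (T : Tree) (V : Fin (Tree.m T) → Subset (Graph.n G))
                     (td : IsTreeDecomposition G T V) where
  open Graph G
  open Tree T
  open IsTreeDecomposition td
  open WalkProperties edge
  open TreeProperties T

  InSideOf : Fin q → Fin m → Fin n → Set
  InSideOf = InSide G T V

  InBothSides : Fin q → Fin n → Set
  InBothSides f x = InSideOf f (proj₁ (edge f)) x × InSideOf f (proj₂ (edge f)) x

  Unique : Fin n → Set
  Unique = InExactlyOneBag G T V

  isolated⇒Unique : ∀ {x t} → x ∈ V t → (∀ {g w} → Link edge g t w → x ∉ V w) → Unique x
  isolated⇒Unique {x} {t} xt isolated = t , xt , λ t′ xt′ → stays (connected-bags x t t′ xt xt′)
    where
    stays : ∀ {t′} → Walk edge (λ _ → ⊤) (λ s → x ∈ V s) t t′ → t′ ≡ t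
    stays (stop _) = refl
    stays (step _ _ l _ rest) = ⊥-elim (isolated l (walk-head rest))

  adjacent-bags⇒InBothSides : ∀ {g t w x} → Link edge g t w → x ∈ V t → x ∈ V w →
                              InBothSides g x
  adjacent-bags⇒InBothSides {x = x} (inj₁ e) xt xw =
    (_ , stop tt , subst (λ s → x ∈ V s) (sym (cong proj₁ e)) xt) ,
    (_ , stop tt , subst (λ s → x ∈ V s) (sym (cong proj₂ e)) xw)
  adjacent-bags⇒InBothSides {x = x} (inj₂ e) xt xw =
    (_ , stop tt , subst (λ s → x ∈ V s) (sym (cong proj₁ e)) xw) ,
    (_ , stop tt , subst (λ s → x ∈ V s) (sym (cong proj₂ e)) xt)

  ¬InBothSides⇒Unique : ∀ {x} → (∀ g → ¬ InBothSides g x) → Unique x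
  ¬InBothSides⇒Unique {x} never with cover-vertices x
  ... | t , xt = isolated⇒Unique xt λ l xw → never _ (adjacent-bags⇒InBothSides l xt xw)

  Unique⇒¬InBothSides : ∀ {x} → Unique x → ∀ g → ¬ InBothSides g x
  Unique⇒¬InBothSides (t , _ , unique) g ((t₁ , s₁ , x₁) , (t₂ , s₂ , x₂)) =
    bridges g (subst (Side g _) (unique t₁ x₁) s₁
               ++ reverse (subst (Side g _) (unique t₂ x₂) s₂))

  leaf-private⇒Unique : ∀ {f t b x} → (∀ g → Incident edge g t → g ≡ f) → Link edge f t b →
                        InSideOf f t x → ¬ InSideOf f b x → x ∈ V t × Unique x
  leaf-private⇒Unique {t = t} {b} {x} only-f lf (t₀ , s , xt₀) x∉b =
    xt , isolated⇒Unique xt isolated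
    where
    xt : x ∈ V t
    xt = subst (λ s → x ∈ V s) (leaf-side-singleton only-f s) xt₀

    isolated : ∀ {g w} → Link edge g t w → x ∉ V w
    isolated lg xw with only-f _ (Link⇒Incident lg)
    ... | refl = x∉b (b , stop tt , subst (λ s → x ∈ V s) (Link-functional lg lf) xw)

  InducesSep⇒both⇔InBothSides : ∀ {g s x} → InducesSep G T V g s →
                                 (x ∈ proj₁ s × x ∈ proj₂ s) ⇔ InBothSides g x
  InducesSep⇒both⇔InBothSides {x = x} (inj₁ (C⇔ , D⇔)) =
    mk⇔ (λ (xC , xD) → to (C⇔ x) xC , to (D⇔ x) xD)
        (λ (x₁ , x₂) → from (C⇔ x) x₁ , from (D⇔ x) x₂)
  InducesSep⇒both⇔InBothSides {x = x} (inj₂ (D⇔ , C⇔)) =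
    mk⇔ (λ (xC , xD) → to (D⇔ x) xD , to (C⇔ x) xC)
        (λ (x₁ , x₂) → from (C⇔ x) x₂ , from (D⇔ x) x₁)

  InducesSep⇒private-vertices :
    ∀ {g s} → InducesSep G T V g s → IsSeparation G s →
    (∃[ x ] (InSideOf g (proj₁ (edge g)) x × ¬ InSideOf g (proj₂ (edge g)) x))
    × (∃[ x ] (InSideOf g (proj₂ (edge g)) x × ¬ InSideOf g (proj₁ (edge g)) x))
  InducesSep⇒private-vertices (inj₁ (C⇔ , D⇔)) (_ , (x , xC , x∉D) , (y , yD , y∉C) , _) =
    (x , to (C⇔ x) xC , λ x₂ → x∉D (from (D⇔ x) x₂)) ,
    (y , to (D⇔ y) yD , λ y₁ → y∉C (from (C⇔ y) y₁))
  InducesSep⇒private-vertices (inj₂ (D⇔ , C⇔)) (_ , (x , xC , x∉D) , (y , yD , y∉C) , _) =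
    (y , to (D⇔ y) yD , λ y₂ → y∉C (from (C⇔ y) y₂)) ,
    (x , to (C⇔ x) xC , λ x₁ → x∉D (from (D⇔ x) x₁))

module Induced (G : Graph) (T : Tree) (V : Fin (Tree.m T) → Subset (Graph.n G))
               {p : ℕ} (S : Fin p → Sep (Graph.n G))
               (separations : ∀ i → IsSeparation G (S i))
               (td : IsTreeDecomposition G T V)
               (induces : Induces G T V S) where
  open Tree T
  open Induces induces
  open TreeProperties T
  open Decomposition G T V td

  Unique⇔in-no-separator : ∀ x → Unique x ⇔ (∀ i → ¬ (x ∈ proj₁ (S i) × x ∈ proj₂ (S i)))
  Unique⇔in-no-separator x = mk⇔
    (λ ux i both → let f , f↦i = onto i in
      Unique⇒¬InBothSides ux f (to (InducesSep⇒both⇔InBothSides f↦i) both))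
    (λ none → ¬InBothSides⇒Unique λ g both → let i , g↦i = into g in
      none i (from (InducesSep⇒both⇔InBothSides g↦i) both))

  leaf-meets-Unique : ∀ t → Leaf t → ∃[ x ] (x ∈ V t × Unique x)
  leaf-meets-Unique _ (f , inj₁ refl , only-f) with into f
  ... | i , f↦i with proj₁ (InducesSep⇒private-vertices f↦i (separations i))
  ...   | x , x₁ , x∉₂ = x , leaf-private⇒Unique only-f (inj₁ refl) x₁ x∉₂
  leaf-meets-Unique _ (f , inj₂ refl , only-f) with into f
  ... | i , f↦i with proj₂ (InducesSep⇒private-vertices f↦i (separations i))
  ...   | x , x₂ , x∉₁ = x , leaf-private⇒Unique only-f (inj₂ refl) x₂ x∉₁

  Side-meets-Unique : ∀ {f u w} → Link edge f w u → ∃[ x ] (InSideOf f u x × Unique x)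
  Side-meets-Unique l with Side-contains-leaf l
  ... | t , s , leaf with leaf-meets-Unique t leaf
  ...   | x , xt , ux = x , (t , s , xt) , ux

  separation-meets-Unique : ∀ i → (∃[ x ] (x ∈ proj₁ (S i) × Unique x))
                                × (∃[ x ] (x ∈ proj₂ (S i) × Unique x))
  separation-meets-Unique i with onto i
  ... | f , f↦i with Side-meets-Unique {f} (inj₂ refl) | Side-meets-Unique {f} (inj₁ refl) | f↦i
  ...   | x , x₁ , ux | y , y₂ , uy | inj₁ (C⇔ , D⇔) =
    (x , from (C⇔ x) x₁ , ux) , (y , from (D⇔ y) y₂ , uy)
  ...   | x , x₁ , ux | y , y₂ , uy | inj₂ (D⇔ , C⇔) =
    (y , from (C⇔ y) y₂ , uy) , (x , from (D⇔ x) x₁ , ux)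

-- Nestedness only ensures that S induces a tree-decomposition.
lemmaB1 : (G : Graph) (T : Tree) (V : Fin (Tree.m T) → Subset (Graph.n G))
          {p : ℕ} (S : Fin p → Sep (Graph.n G)) →
          (∀ i → IsSeparation G (S i)) →
          (∀ i j → Nested (S i) (S j)) →
          IsTreeDecomposition G T V →
          Induces G T V S →
          ((x : Fin (Graph.n G)) →
             InExactlyOneBag G T V x ⇔ (∀ i → ¬ (x ∈ proj₁ (S i) × x ∈ proj₂ (S i))))
          × ((t : Fin (Tree.m T)) → Tree.Leaf T t →
             ∃[ x ] (x ∈ V t × InExactlyOneBag G T V x))
          × ((i : Fin p) →
             (∃[ x ] (x ∈ proj₁ (S i) × InExactlyOneBag G T V x))
             × (∃[ x ] (x ∈ proj₂ (S i) × InExactlyOneBag G T V x)))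
lemmaB1 G T V S separations _ td induces =
  Unique⇔in-no-separator , leaf-meets-Unique , separation-meets-Unique
  where open Induced G T V S separations td induces
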